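{- Let $m\ge1$ and let $x,y$ be nonnegative integers with $my<x$. Then the Zeta polynomial of the poset $\mathscr{P}^F_{m,x,y}$ is $$Z^F_{m,x,y}(u)=\frac{(x-my-1)(u-1)+1}{y!}\prod_{j=2}^{y}\bigl((x-1)(u-1)+j\bigr),$$ with the convention that a product $\prod_{j=2}^{y}\alpha_j$ equals $1$ when $y=1$ and equals $1/\alpha_1$ when $y=0$.
   Context: For integers $m\ge1$ and $x,y\ge0$ with $my<x$, $\mathscr{P}^F_{m,x,y}$ is the set of words $(a_1,\dots,a_{x-1})$ of nonnegative integers such that $m\sum_{i\le j}a_i<j$ for all $1\le j\le x-1$ and $\sum_ia_i\le y$, partially ordered term-wise (equivalently, lattice paths with unit steps east and north from $(0,0)$ to $(x,y)$ staying strictly below the line $my=x$ except at the origin, where $a_i$ is the number of north steps between the $i$-th and $(i+1)$-th east steps). The Zeta polynomial of a finite poset $P$ is the polynomial $Z(u)$ such that for every integer $q\ge2$, $Z(q)$ is the number of multichains $e_1\le e_2\le\cdots\le e_{q-1}$ in $P$. -}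

module Defs where

open import Data.Bool using (Bool; true; false; _∧_)
open import Data.Nat using (ℕ; zero; suc; _+_; _*_; _∸_; _<ᵇ_; _≤ᵇ_)
open import Data.List using (List; []; _∷_; map; concatMap; filterᵇ; length; upTo)
open import Data.Nat.ListAction using (product)
open import Data.Vec using (Vec; []; _∷_)

vecsUpTo : (n b : ℕ) → List (Vec ℕ n)
vecsUpTo zero    b = [] ∷ []
vecsUpTo (suc n) b = concatMap (λ a → map (a ∷_) (vecsUpTo n b)) (upTo (suc b))

vsum : ∀ {n} → Vec ℕ n → ℕ
vsum []      = 0
vsum (a ∷ w) = a + vsum w

-- prefixOK m j s w : for the word w whose first letter is a_j, with s = a_1+…+a_{j-1},
-- checks m * (a_1+…+a_k) < k for every k ≥ j.
prefixOK : ∀ {n} → (m j s : ℕ) → Vec ℕ n → Bool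
prefixOK m j s []      = true
prefixOK m j s (a ∷ w) = (m * (s + a) <ᵇ j) ∧ prefixOK m (suc j) (s + a) w

inPF : (m x y : ℕ) → Vec ℕ (x ∸ 1) → Bool
inPF m x y w = prefixOK m 1 0 w ∧ (vsum w ≤ᵇ y)

-- The elements of P^F_{m,x,y} (every element has all entries ≤ y, so this is all of them).
PF : (m x y : ℕ) → List (Vec ℕ (x ∸ 1))
PF m x y = filterᵇ (inPF m x y) (vecsUpTo (x ∸ 1) y)

_≤ʷ_ : ∀ {n} → Vec ℕ n → Vec ℕ n → Bool
[]      ≤ʷ []      = true
(a ∷ v) ≤ʷ (b ∷ w) = (a ≤ᵇ b) ∧ (v ≤ʷ w)

tuples : ∀ {A : Set} → ℕ → List A → List (List A)
tuples zero    L = [] ∷ []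
tuples (suc k) L = concatMap (λ e → map (e ∷_) (tuples k L)) L

isMultichain : ∀ {n} → List (Vec ℕ n) → Bool
isMultichain []               = true
isMultichain (e ∷ [])         = true
isMultichain (e ∷ f ∷ rest)   = (e ≤ʷ f) ∧ isMultichain (f ∷ rest)

-- Number of multichains e_1 ≤ … ≤ e_{q-1} in P^F_{m,x,y}, i.e. Z^F_{m,x,y}(q) for q ≥ 2.
multichainCount : (m x y q : ℕ) → ℕ
multichainCount m x y q = length (filterᵇ isMultichain (tuples (q ∸ 1) (PF m x y)))

prodFrom1 : (x y q : ℕ) → ℕ
prodFrom1 x y q = product (map (λ i → (x ∸ 1) * (q ∸ 1) + suc i) (upTo y))

-- Multichains e₁ ≤ ⋯ ≤ e_{q-1} are grouped by their top element f. Since P^F_{m,x,y} is a down-set of the box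
-- [0, y]^{x-1}, the chains below f number ∏ᵢ C(fᵢ + q - 2, q - 2), so Z(q) is a weighted count of ballot words.
-- Appending a letter convolves the weighted count at fixed letter sum t with C(a + q - 2, q - 2), i.e. takes q - 1
-- prefix sums in t, and C(X + t - 1, t) - L·C(X + t - 1, t - 1) turns into the same expression for X + 1 under a
-- prefix sum as long as L t ≤ X, while the ballot condition removes exactly the sums t with L t > X. With
-- L = m(q - 1) this gives the weighted count at each sum t, and summing over t ≤ y yields the closed form with
-- X = (x - 1)(q - 1) + 1, which is the stated product once multiplied by y! and X.

module Submission where

open import Defs
open import Data.Bool using (Bool; true; false; _∧_; T)
open import Data.Bool.Properties using (T-∧; ∧-assoc; ∧-identityʳ)
open import Data.Empty using (⊥-elim)
open import Data.List using (List; []; _∷_; _++_; map; concatMap; filterᵇ; length; upTo; applyUpTo)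
open import Data.List.Properties using (map-applyUpTo)
open import Data.Nat
open import Data.Nat.Properties
open import Data.Nat.ListAction using (product)
open import Data.Nat.Solver using (module +-*-Solver)
open import Data.Product using (_,_; proj₂)
open import Data.Unit using (tt)
open import Data.Vec using (Vec; []; _∷_; _∷ʳ_)
open import Data.Vec.Relation.Unary.All using (All; []; _∷_)
open import Function using (_∘_; Equivalence)
open import Relation.Nullary using (¬_)
open import Relation.Nullary.Reflects using (Reflects; ofʸ; ofⁿ)
open import Relation.Binary.PropositionalEquality
open +-*-Solver

𝟙 : Bool → ℕ
𝟙 true  = 1
𝟙 false = 0

𝟙-∧ : ∀ a b → 𝟙 (a ∧ b) ≡ 𝟙 a * 𝟙 b
𝟙-∧ true  b = sym (*-identityˡ (𝟙 b))
𝟙-∧ false b = refl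

𝟙-true : ∀ {b} → T b → 𝟙 b ≡ 1
𝟙-true {true} _ = refl

𝟙-false : ∀ {b} → ¬ T b → 𝟙 b ≡ 0
𝟙-false {true}  ¬b = ⊥-elim (¬b tt)
𝟙-false {false} _  = refl

𝟙*-cong : ∀ b {x y} → (T b → x ≡ y) → 𝟙 b * x ≡ 𝟙 b * y
𝟙*-cong true  eq = cong (_+ 0) (eq tt)
𝟙*-cong false eq = refl

𝟙-⇔ : ∀ {a b} → (T a → T b) → (T b → T a) → 𝟙 a ≡ 𝟙 b
𝟙-⇔ {true}  {true}  _ _ = refl
𝟙-⇔ {true}  {false} f _ = ⊥-elim (f tt)
𝟙-⇔ {false} {true}  _ g = ⊥-elim (g tt)
𝟙-⇔ {false} {false} _ _ = refl

𝟙-≡ᵇ-+ : ∀ v a t → 𝟙 (v + a ≡ᵇ t) ≡ 𝟙 (a ≤ᵇ t) * 𝟙 (v ≡ᵇ t ∸ a)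
𝟙-≡ᵇ-+ v a t with a ≤ᵇ t | ≤ᵇ-reflects-≤ a t
... | false | ofⁿ a≰t = 𝟙-false (λ eq → a≰t (subst (a ≤_) (≡ᵇ⇒≡ (v + a) t eq) (m≤n+m a v)))
... | true  | ofʸ a≤t = trans (𝟙-⇔ to from) (sym (*-identityˡ _))
  where
  to : T (v + a ≡ᵇ t) → T (v ≡ᵇ t ∸ a)
  to eq = ≡⇒≡ᵇ v (t ∸ a) (trans (sym (m+n∸n≡m v a)) (cong (_∸ a) (≡ᵇ⇒≡ (v + a) t eq)))
  from : T (v ≡ᵇ t ∸ a) → T (v + a ≡ᵇ t)
  from eq = ≡⇒≡ᵇ (v + a) t (trans (cong (_+ a) (≡ᵇ⇒≡ v (t ∸ a) eq)) (m∸n+n≡m a≤t))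

𝟙-∧-at : ∀ P (g : ℕ → Bool) v t → 𝟙 (P ∧ g v) * 𝟙 (v ≡ᵇ t) ≡ 𝟙 (g t) * (𝟙 P * 𝟙 (v ≡ᵇ t))
𝟙-∧-at P g v t with v ≡ᵇ t in v=t
... | false = trans (*-zeroʳ (𝟙 (P ∧ g v))) (sym (trans (cong (𝟙 (g t) *_) (*-zeroʳ (𝟙 P))) (*-zeroʳ (𝟙 (g t)))))
... | true with ≡ᵇ⇒≡ v t (subst T (sym v=t) tt)
...   | refl rewrite 𝟙-∧ P (g v) =
  solve 2 (λ p q → p :* q :* con 1 := q :* (p :* con 1)) refl (𝟙 P) (𝟙 (g v))

*-comm-middle : ∀ a b c → a * b * c ≡ a * c * b
*-comm-middle = solve 3 (λ a b c → a :* b :* c := a :* c :* b) refl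

∑ : {A : Set} → List A → (A → ℕ) → ℕ
∑ []       f = 0
∑ (x ∷ xs) f = f x + ∑ xs f

syntax ∑ L (λ x → e) = ∑[ x ∈ L ] e

module _ {A : Set} where

  ∑-cong : ∀ (L : List A) {f g : A → ℕ} → (∀ x → f x ≡ g x) → ∑ L f ≡ ∑ L g
  ∑-cong []      eq = refl
  ∑-cong (x ∷ L) eq = cong₂ _+_ (eq x) (∑-cong L eq)

  ∑-++ : ∀ (xs ys : List A) f → ∑ (xs ++ ys) f ≡ ∑ xs f + ∑ ys f
  ∑-++ []       ys f = refl
  ∑-++ (x ∷ xs) ys f = trans (cong (f x +_) (∑-++ xs ys f)) (sym (+-assoc (f x) _ _))

  ∑-+ : ∀ (L : List A) f g → ∑[ x ∈ L ] (f x + g x) ≡ ∑ L f + ∑ L g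
  ∑-+ []      f g = refl
  ∑-+ (x ∷ L) f g rewrite ∑-+ L f g =
    solve 4 (λ a b c d → (a :+ b) :+ (c :+ d) := (a :+ c) :+ (b :+ d)) refl (f x) (g x) (∑ L f) (∑ L g)

  ∑-*ˡ : ∀ (L : List A) c f → ∑[ x ∈ L ] (c * f x) ≡ c * ∑ L f
  ∑-*ˡ []      c f = sym (*-zeroʳ c)
  ∑-*ˡ (x ∷ L) c f rewrite ∑-*ˡ L c f = sym (*-distribˡ-+ c (f x) (∑ L f))

  ∑-*ʳ : ∀ (L : List A) c f → ∑[ x ∈ L ] (f x * c) ≡ ∑ L f * c
  ∑-*ʳ L c f = trans (∑-cong L (λ x → *-comm (f x) c)) (trans (∑-*ˡ L c f) (*-comm c _))

  ∑-zero : ∀ (L : List A) → ∑[ x ∈ L ] 0 ≡ 0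
  ∑-zero []      = refl
  ∑-zero (x ∷ L) = ∑-zero L

  ∑-filterᵇ : ∀ (p : A → Bool) (L : List A) f → ∑ (filterᵇ p L) f ≡ ∑[ x ∈ L ] (𝟙 (p x) * f x)
  ∑-filterᵇ p []      f = refl
  ∑-filterᵇ p (x ∷ L) f with p x
  ... | true  = cong₂ _+_ (sym (+-identityʳ (f x))) (∑-filterᵇ p L f)
  ... | false = ∑-filterᵇ p L f

  length-filterᵇ : ∀ (p : A → Bool) (L : List A) → length (filterᵇ p L) ≡ ∑[ x ∈ L ] 𝟙 (p x)
  length-filterᵇ p []      = refl
  length-filterᵇ p (x ∷ L) with p x
  ... | true  = cong suc (length-filterᵇ p L)
  ... | false = length-filterᵇ p L

module _ {A B : Set} where

  ∑-map : ∀ (g : A → B) (L : List A) f → ∑ (map g L) f ≡ ∑ L (f ∘ g)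
  ∑-map g []      f = refl
  ∑-map g (x ∷ L) f = cong (f (g x) +_) (∑-map g L f)

  ∑-concatMap : ∀ (g : A → List B) (L : List A) f → ∑ (concatMap g L) f ≡ ∑[ x ∈ L ] ∑ (g x) f
  ∑-concatMap g []      f = refl
  ∑-concatMap g (x ∷ L) f =
    trans (∑-++ (g x) (concatMap g L) f) (cong (∑ (g x) f +_) (∑-concatMap g L f))

  ∑-comm : ∀ (L : List A) (M : List B) (f : A → B → ℕ) →
    ∑[ x ∈ L ] ∑[ y ∈ M ] f x y ≡ ∑[ y ∈ M ] ∑[ x ∈ L ] f x y
  ∑-comm []      M f = sym (∑-zero M)
  ∑-comm (x ∷ L) M f =
    trans (cong (∑ M (f x) +_) (∑-comm L M f)) (sym (∑-+ M (f x) (λ y → ∑[ x ∈ L ] f x y)))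

∑≤ : (ℕ → ℕ) → ℕ → ℕ
∑≤ f zero    = f 0
∑≤ f (suc t) = f 0 + ∑≤ (f ∘ suc) t

syntax ∑≤ (λ a → e) t = ∑[ a ≤ t ] e

∑-applyUpTo : ∀ (g : ℕ → ℕ) t f → ∑ (applyUpTo g (suc t)) f ≡ ∑≤ (f ∘ g) t
∑-applyUpTo g zero    f = +-identityʳ (f (g 0))
∑-applyUpTo g (suc t) f = cong (f (g 0) +_) (∑-applyUpTo (g ∘ suc) t f)

∑-upTo : ∀ t f → ∑ (upTo (suc t)) f ≡ ∑≤ f t
∑-upTo t f = ∑-applyUpTo (λ a → a) t f

∑≤-snoc : ∀ f t → ∑≤ f (suc t) ≡ ∑≤ f t + f (suc t)
∑≤-snoc f zero    = refl
∑≤-snoc f (suc t) = trans (cong (f 0 +_) (∑≤-snoc (f ∘ suc) t)) (sym (+-assoc (f 0) _ _))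

∑≤-cong : ∀ {f g} t → (∀ a → a ≤ t → f a ≡ g a) → ∑≤ f t ≡ ∑≤ g t
∑≤-cong zero    eq = eq 0 z≤n
∑≤-cong (suc t) eq = cong₂ _+_ (eq 0 z≤n) (∑≤-cong t (λ a a≤t → eq (suc a) (s≤s a≤t)))

∑≤-zero : ∀ t → ∑[ a ≤ t ] 0 ≡ 0
∑≤-zero zero    = refl
∑≤-zero (suc t) = ∑≤-zero t

∑≤-+ : ∀ f g t → ∑[ a ≤ t ] (f a + g a) ≡ ∑≤ f t + ∑≤ g t
∑≤-+ f g zero    = refl
∑≤-+ f g (suc t) rewrite ∑≤-+ (f ∘ suc) (g ∘ suc) t =
  solve 4 (λ a b c d → (a :+ b) :+ (c :+ d) := (a :+ c) :+ (b :+ d)) refl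
    (f 0) (g 0) (∑≤ (f ∘ suc) t) (∑≤ (g ∘ suc) t)

∑≤-*ˡ : ∀ c f t → ∑[ a ≤ t ] (c * f a) ≡ c * ∑≤ f t
∑≤-*ˡ c f zero    = refl
∑≤-*ˡ c f (suc t) rewrite ∑≤-*ˡ c (f ∘ suc) t = sym (*-distribˡ-+ c (f 0) _)

∑≤-*ʳ : ∀ c f t → ∑[ a ≤ t ] (f a * c) ≡ ∑≤ f t * c
∑≤-*ʳ c f t = trans (∑≤-cong t (λ a _ → *-comm (f a) c)) (trans (∑≤-*ˡ c f t) (*-comm c _))

∑-∑≤ : ∀ {A : Set} (L : List A) (g : A → ℕ → ℕ) t →
  ∑[ x ∈ L ] ∑≤ (g x) t ≡ ∑[ u ≤ t ] ∑[ x ∈ L ] g x u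
∑-∑≤ L g zero    = refl
∑-∑≤ L g (suc t) =
  trans (∑-+ L (λ x → g x 0) (λ x → ∑≤ (g x ∘ suc) t))
        (cong (∑[ x ∈ L ] g x 0 +_) (∑-∑≤ L (λ x u → g x (suc u)) t))

∑≤-restrict : ∀ g {c b} → c ≤ b → ∑[ a ≤ b ] (𝟙 (a ≤ᵇ c) * g a) ≡ ∑≤ g c
∑≤-restrict g {c} {b} c≤b = trans (cong (∑≤ h) (sym (m+[n∸m]≡n c≤b))) (beyond (b ∸ c))
  where
  h : ℕ → ℕ
  h a = 𝟙 (a ≤ᵇ c) * g a
  beyond : ∀ d → ∑≤ h (c + d) ≡ ∑≤ g c
  beyond zero = trans (cong (∑≤ h) (+-identityʳ c))
    (∑≤-cong c (λ a a≤c → trans (cong (_* g a) (𝟙-true (≤⇒≤ᵇ a≤c))) (*-identityˡ (g a))))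
  beyond (suc d) = begin
    ∑≤ h (c + suc d)                  ≡⟨ cong (∑≤ h) (+-suc c d) ⟩
    ∑≤ h (suc (c + d))                ≡⟨ ∑≤-snoc h (c + d) ⟩
    ∑≤ h (c + d) + h (suc (c + d))    ≡⟨ cong (λ z → ∑≤ h (c + d) + z * g (suc (c + d))) (𝟙-false c+d+1≰c) ⟩
    ∑≤ h (c + d) + 0                  ≡⟨ +-identityʳ _ ⟩
    ∑≤ h (c + d)                      ≡⟨ beyond d ⟩
    ∑≤ g c                            ∎
    where
    open ≡-Reasoning
    c+d+1≰c : ¬ T (suc (c + d) ≤ᵇ c)
    c+d+1≰c le = <⇒≱ (s≤s (m≤m+n c d)) (≤ᵇ⇒≤ _ c le)

≤ᵇ≡<ᵇ-suc : ∀ v y → (v ≤ᵇ y) ≡ (v <ᵇ suc y)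
≤ᵇ≡<ᵇ-suc zero    y = refl
≤ᵇ≡<ᵇ-suc (suc v) y = refl

∑≤-𝟙≡ᵇ : ∀ v y → ∑[ u ≤ y ] 𝟙 (v ≡ᵇ u) ≡ 𝟙 (v ≤ᵇ y)
∑≤-𝟙≡ᵇ zero    zero    = refl
∑≤-𝟙≡ᵇ (suc v) zero    = refl
∑≤-𝟙≡ᵇ zero    (suc y) = cong suc (∑≤-zero y)
∑≤-𝟙≡ᵇ (suc v) (suc y) = trans (∑≤-𝟙≡ᵇ v y) (cong 𝟙 (≤ᵇ≡<ᵇ-suc v y))

infixl 7 _⋆_

_⋆_ : (ℕ → ℕ) → (ℕ → ℕ) → ℕ → ℕ
(g ⋆ h) t = ∑[ a ≤ t ] (g a * h (t ∸ a))

⋆-congʳ : ∀ g {h h′} t → (∀ d → d ≤ t → h d ≡ h′ d) → (g ⋆ h) t ≡ (g ⋆ h′) t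
⋆-congʳ g t eq = ∑≤-cong t (λ a _ → cong (g a *_) (eq (t ∸ a) (m∸n≤m t a)))

1⋆ : ∀ h t → ((λ _ → 1) ⋆ h) t ≡ ∑≤ h t
1⋆ h zero    = +-identityʳ (h 0)
1⋆ h (suc t) = begin
  (h (suc t) + 0) + ((λ _ → 1) ⋆ h) t    ≡⟨ cong₂ _+_ (+-identityʳ (h (suc t))) (1⋆ h t) ⟩
  h (suc t) + ∑≤ h t                      ≡⟨ +-comm (h (suc t)) _ ⟩
  ∑≤ h t + h (suc t)                      ≡⟨ ∑≤-snoc h t ⟨
  ∑≤ h (suc t)                            ∎
  where open ≡-Reasoning

-- (∑≤ g ⋆ h) t and (g ⋆ ∑≤ h) t are both the sum of g a * h c over a + c ≤ t.
∑≤-⋆ : ∀ g h t → (∑≤ g ⋆ h) t ≡ (g ⋆ ∑≤ h) t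
∑≤-⋆ g h zero    = refl
∑≤-⋆ g h (suc t) = begin
    g 0 * h (suc t) + (∑≤ g ∘ suc ⋆ h) t
  ≡⟨ cong (g 0 * h (suc t) +_) (∑≤-cong t (λ a _ → *-distribʳ-+ (h (t ∸ a)) (g 0) (∑≤ (g ∘ suc) a))) ⟩
    g 0 * h (suc t) + ∑[ a ≤ t ] (g 0 * h (t ∸ a) + ∑≤ (g ∘ suc) a * h (t ∸ a))
  ≡⟨ cong (g 0 * h (suc t) +_) (∑≤-+ _ _ t) ⟩
    g 0 * h (suc t) + (∑[ a ≤ t ] (g 0 * h (t ∸ a)) + (∑≤ (g ∘ suc) ⋆ h) t)
  ≡⟨ cong₂ (λ u v → g 0 * h (suc t) + (u + v))
       (trans (∑≤-*ˡ (g 0) (λ a → h (t ∸ a)) t) (cong (g 0 *_) (trans (sym (∑≤-cong t (λ a _ → +-identityʳ (h (t ∸ a))))) (1⋆ h t))))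
       (∑≤-⋆ (g ∘ suc) h t) ⟩
    g 0 * h (suc t) + (g 0 * ∑≤ h t + (g ∘ suc ⋆ ∑≤ h) t)
  ≡⟨ solve 4 (λ g a p c → g :* a :+ (g :* p :+ c) := g :* (p :+ a) :+ c) refl
       (g 0) (h (suc t)) (∑≤ h t) ((g ∘ suc ⋆ ∑≤ h) t) ⟩
    g 0 * (∑≤ h t + h (suc t)) + (g ∘ suc ⋆ ∑≤ h) t
  ≡⟨ cong (λ z → g 0 * z + (g ∘ suc ⋆ ∑≤ h) t) (sym (∑≤-snoc h t)) ⟩
    (g ⋆ ∑≤ h) (suc t)
  ∎
  where open ≡-Reasoning

module Multichains {n : ℕ} (L : List (Vec ℕ n)) where

  chainsAbove : ℕ → Vec ℕ n → ℕ
  chainsAbove k c = ∑[ es ∈ tuples k L ] 𝟙 (isMultichain (c ∷ es))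

  chainsBelow : ℕ → Vec ℕ n → ℕ
  chainsBelow zero    f = 1
  chainsBelow (suc k) f = ∑[ e ∈ L ] (𝟙 (e ≤ʷ f) * chainsBelow k e)

  private
    ∑-tuples-suc : ∀ k (F : List (Vec ℕ n) → ℕ) →
      ∑ (tuples (suc k) L) F ≡ ∑[ e ∈ L ] ∑[ es ∈ tuples k L ] F (e ∷ es)
    ∑-tuples-suc k F = trans (∑-concatMap (λ e → map (e ∷_) (tuples k L)) L F)
                             (∑-cong L (λ e → ∑-map (e ∷_) (tuples k L) F))

  chainsAbove-suc : ∀ k c → chainsAbove (suc k) c ≡ ∑[ e ∈ L ] (𝟙 (c ≤ʷ e) * chainsAbove k e)
  chainsAbove-suc k c = trans (∑-tuples-suc k _) (∑-cong L (λ e →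
    trans (∑-cong (tuples k L) (λ es → 𝟙-∧ (c ≤ʷ e) (isMultichain (e ∷ es))))
          (∑-*ˡ (tuples k L) (𝟙 (c ≤ʷ e)) _)))

  chainsBelow-chainsAbove : ∀ i j →
    ∑[ c ∈ L ] (chainsBelow i c * chainsAbove (suc j) c) ≡ ∑[ c ∈ L ] (chainsBelow (suc i) c * chainsAbove j c)
  chainsBelow-chainsAbove i j = begin
      ∑[ c ∈ L ] (chainsBelow i c * chainsAbove (suc j) c)
    ≡⟨ ∑-cong L (λ c → trans (cong (chainsBelow i c *_) (chainsAbove-suc j c)) (sym (∑-*ˡ L (chainsBelow i c) _))) ⟩
      ∑[ c ∈ L ] ∑[ e ∈ L ] (chainsBelow i c * (𝟙 (c ≤ʷ e) * chainsAbove j e))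
    ≡⟨ ∑-comm L L _ ⟩
      ∑[ e ∈ L ] ∑[ c ∈ L ] (chainsBelow i c * (𝟙 (c ≤ʷ e) * chainsAbove j e))
    ≡⟨ ∑-cong L (λ e → trans (∑-cong L (λ c → reorder (chainsBelow i c) (𝟙 (c ≤ʷ e)) (chainsAbove j e)))
                              (∑-*ʳ L (chainsAbove j e) _)) ⟩
      ∑[ e ∈ L ] (chainsBelow (suc i) e * chainsAbove j e)
    ∎
    where
    open ≡-Reasoning
    reorder : ∀ a b c → a * (b * c) ≡ (b * a) * c
    reorder = solve 3 (λ a b c → a :* (b :* c) := (b :* a) :* c) refl

  countMultichains : ∀ k → ∑[ es ∈ tuples (suc k) L ] 𝟙 (isMultichain es) ≡ ∑ L (chainsBelow k)
  countMultichains k = begin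
      ∑[ es ∈ tuples (suc k) L ] 𝟙 (isMultichain es)
    ≡⟨ ∑-tuples-suc k _ ⟩
      ∑ L (chainsAbove k)
    ≡⟨ ∑-cong L (λ c → sym (*-identityˡ (chainsAbove k c))) ⟩
      ∑[ c ∈ L ] (chainsBelow 0 c * chainsAbove k c)
    ≡⟨ transfer 0 k ⟩
      ∑ L (chainsBelow (k + 0))
    ≡⟨ cong (λ z → ∑ L (chainsBelow z)) (+-identityʳ k) ⟩
      ∑ L (chainsBelow k)
    ∎
    where
    open ≡-Reasoning
    transfer : ∀ i j → ∑[ c ∈ L ] (chainsBelow i c * chainsAbove j c) ≡ ∑ L (chainsBelow (j + i))
    transfer i zero    = ∑-cong L (λ c → *-identityʳ (chainsBelow i c))
    transfer i (suc j) = trans (chainsBelow-chainsAbove i j)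
      (trans (transfer (suc i) j) (cong (λ z → ∑ L (chainsBelow z)) (+-suc j i)))

-- ω K a = C(a + K, K) is the number of multichains of length K in the chain 0 < 1 < … < a,
-- so Ω K f is the number of multichains of length K in the box below f.
ω : ℕ → ℕ → ℕ
ω zero    a = 1
ω (suc K) a = ∑≤ (ω K) a

Ω : ∀ {n} → ℕ → Vec ℕ n → ℕ
Ω K []      = 1
Ω K (a ∷ w) = ω K a * Ω K w

∑-box-≤ʷ : ∀ {n} K b {f : Vec ℕ n} → All (_≤ b) f →
  ∑[ e ∈ vecsUpTo n b ] (𝟙 (e ≤ʷ f) * Ω K e) ≡ Ω (suc K) f
∑-box-≤ʷ K b []                       = refl
∑-box-≤ʷ {suc n} K b {c ∷ f} (c≤b ∷ f≤b) = begin
    ∑[ e ∈ vecsUpTo (suc n) b ] (𝟙 (e ≤ʷ (c ∷ f)) * Ω K e)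
  ≡⟨ ∑-concatMap (λ a → map (a ∷_) (vecsUpTo n b)) (upTo (suc b)) _ ⟩
    ∑[ a ∈ upTo (suc b) ] ∑[ e ∈ map (a ∷_) (vecsUpTo n b) ] (𝟙 (e ≤ʷ (c ∷ f)) * Ω K e)
  ≡⟨ ∑-cong (upTo (suc b)) (λ a → trans (∑-map (a ∷_) (vecsUpTo n b) _)
       (trans (∑-cong (vecsUpTo n b) (λ w → split (a ≤ᵇ c) (w ≤ʷ f) (ω K a) (Ω K w)))
              (∑-*ˡ (vecsUpTo n b) (𝟙 (a ≤ᵇ c) * ω K a) _))) ⟩
    ∑[ a ∈ upTo (suc b) ] ((𝟙 (a ≤ᵇ c) * ω K a) * ∑[ w ∈ vecsUpTo n b ] (𝟙 (w ≤ʷ f) * Ω K w))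
  ≡⟨ ∑-*ʳ (upTo (suc b)) _ (λ a → 𝟙 (a ≤ᵇ c) * ω K a) ⟩
    ∑[ a ∈ upTo (suc b) ] (𝟙 (a ≤ᵇ c) * ω K a) * ∑[ w ∈ vecsUpTo n b ] (𝟙 (w ≤ʷ f) * Ω K w)
  ≡⟨ cong₂ _*_ (trans (∑-upTo b _) (∑≤-restrict (ω K) c≤b)) (∑-box-≤ʷ K b f≤b) ⟩
    ω (suc K) c * Ω (suc K) f
  ∎
  where
  open ≡-Reasoning
  split : ∀ p q x y → 𝟙 (p ∧ q) * (x * y) ≡ (𝟙 p * x) * (𝟙 q * y)
  split p q x y rewrite 𝟙-∧ p q =
    solve 4 (λ p q x y → (p :* q) :* (x :* y) := (p :* x) :* (q :* y)) refl (𝟙 p) (𝟙 q) x y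

Ω-zero : ∀ {n} (f : Vec ℕ n) → Ω 0 f ≡ 1
Ω-zero []      = refl
Ω-zero (a ∷ f) = trans (+-identityʳ (Ω 0 f)) (Ω-zero f)

module Downset {n b : ℕ} (p : Vec ℕ n → Bool)
  (p-bounded : ∀ {e} → T (p e) → All (_≤ b) e)
  (p-downward : ∀ {e f} → T (e ≤ʷ f) → T (p f) → T (p e)) where

  open Multichains (filterᵇ p (vecsUpTo n b))

  chainsBelow≡Ω : ∀ K {f} → T (p f) → chainsBelow K f ≡ Ω K f
  chainsBelow≡Ω zero    {f} _  = sym (Ω-zero f)
  chainsBelow≡Ω (suc K) {f} pf = begin
      ∑[ e ∈ filterᵇ p (vecsUpTo n b) ] (𝟙 (e ≤ʷ f) * chainsBelow K e)
    ≡⟨ ∑-filterᵇ p (vecsUpTo n b) _ ⟩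
      ∑[ e ∈ vecsUpTo n b ] (𝟙 (p e) * (𝟙 (e ≤ʷ f) * chainsBelow K e))
    ≡⟨ ∑-cong (vecsUpTo n b) term ⟩
      ∑[ e ∈ vecsUpTo n b ] (𝟙 (e ≤ʷ f) * Ω K e)
    ≡⟨ ∑-box-≤ʷ K b (p-bounded pf) ⟩
      Ω (suc K) f
    ∎
    where
    open ≡-Reasoning
    term : ∀ e → 𝟙 (p e) * (𝟙 (e ≤ʷ f) * chainsBelow K e) ≡ 𝟙 (e ≤ʷ f) * Ω K e
    term e with p e in pe
    ... | true  = trans (+-identityʳ _) (cong (𝟙 (e ≤ʷ f) *_) (chainsBelow≡Ω K (subst T (sym pe) tt)))
    ... | false with e ≤ʷ f in e≤f
    ...   | false = refl
    ...   | true  = ⊥-elim (subst T pe (p-downward (subst T (sym e≤f) tt) pf))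

-- multichoose X t = C(X + t - 1, t) and multichoose′ X t = C(X + t - 1, t - 1), which is 0 for t = 0.
multichoose : ℕ → ℕ → ℕ
multichoose X       zero    = 1
multichoose zero    (suc t) = 0
multichoose (suc X) (suc t) = multichoose (suc X) t + multichoose X (suc t)

multichoose′ : ℕ → ℕ → ℕ
multichoose′ X zero    = 0
multichoose′ X (suc t) = multichoose (suc X) t

multichoose-1 : ∀ X → multichoose X 1 ≡ X
multichoose-1 zero    = refl
multichoose-1 (suc X) = cong suc (multichoose-1 X)

multichoose-absorb-suc : ∀ X t → suc t * multichoose X (suc t) ≡ X * multichoose (suc X) t
multichoose-absorb-suc zero    t       = *-zeroʳ (suc t)
multichoose-absorb-suc (suc X) zero    =
  trans (+-identityʳ _) (cong suc (trans (multichoose-1 X) (sym (*-identityʳ X))))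
multichoose-absorb-suc (suc X) (suc t) = begin
    (2 + t) * (a + b)
  ≡⟨ solve 3 (λ t a b → (con 2 :+ t) :* (a :+ b) := (con 1 :+ t) :* a :+ a :+ (con 2 :+ t) :* b) refl t a b ⟩
    (1 + t) * a + a + (2 + t) * b
  ≡⟨ cong₂ (λ u v → u + a + v) (multichoose-absorb-suc (suc X) t) (multichoose-absorb-suc X (suc t)) ⟩
    (1 + X) * c + a + X * a
  ≡⟨ solve 3 (λ X c a → (con 1 :+ X) :* c :+ a :+ X :* a := (con 1 :+ X) :* (c :+ a)) refl X c a ⟩
    (1 + X) * (c + a)
  ∎
  where
  open ≡-Reasoning
  a = multichoose (suc X) (suc t)
  b = multichoose X (suc (suc t))
  c = multichoose (suc (suc X)) t

multichoose-absorb : ∀ X t → t * multichoose X t ≡ X * multichoose′ X t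
multichoose-absorb X zero    = sym (*-zeroʳ X)
multichoose-absorb X (suc t) = multichoose-absorb-suc X t

rising : ℕ → ℕ → ℕ
rising X t = product (applyUpTo (λ i → X + suc i) t)

rising-suc : ∀ X t → rising X (suc t) ≡ suc X * rising (suc X) t
rising-suc X t = cong₂ _*_ (+-comm X 1) (cong product (applyUpTo-cong t (λ i → +-suc X (suc i))))
  where
  applyUpTo-cong : ∀ {f g : ℕ → ℕ} n → (∀ i → f i ≡ g i) → applyUpTo f n ≡ applyUpTo g n
  applyUpTo-cong zero    eq = refl
  applyUpTo-cong (suc n) eq = cong₂ _∷_ (eq 0) (applyUpTo-cong n (λ i → eq (suc i)))

multichoose-! : ∀ X t → multichoose (suc X) t * t ! ≡ rising X t
multichoose-! X zero    = refl
multichoose-! X (suc t) = begin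
    multichoose (suc X) (suc t) * (suc t * t !)
  ≡⟨ solve 3 (λ m s f → m :* (s :* f) := s :* m :* f) refl (multichoose (suc X) (suc t)) (suc t) (t !) ⟩
    suc t * multichoose (suc X) (suc t) * t !
  ≡⟨ cong (_* t !) (multichoose-absorb-suc (suc X) t) ⟩
    suc X * multichoose (suc (suc X)) t * t !
  ≡⟨ *-assoc (suc X) (multichoose (suc (suc X)) t) (t !) ⟩
    suc X * (multichoose (suc (suc X)) t * t !)
  ≡⟨ cong (suc X *_) (multichoose-! (suc X) t) ⟩
    suc X * rising (suc X) t
  ≡⟨ rising-suc X t ⟨
    rising X (suc t)
  ∎
  where open ≡-Reasoning

-- For L t ≤ X, ballot L X t = (X - L t)/X · C(X + t - 1, t); for t ≥ 1 and X ≤ L t the truncated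
-- subtraction makes it 0 (ballot-vanishes), as the weighted count of ballot words requires.
ballot : ℕ → ℕ → ℕ → ℕ
ballot L X t = multichoose X t ∸ L * multichoose′ X t

ballot-zero : ∀ L X → ballot L X 0 ≡ 1
ballot-zero L X = cong (1 ∸_) (*-zeroʳ L)

L*multichoose′≤multichoose : ∀ L X t → L * t ≤ X → L * multichoose′ X t ≤ multichoose X t
L*multichoose′≤multichoose L X zero    _  = subst (_≤ 1) (sym (*-zeroʳ L)) z≤n
L*multichoose′≤multichoose L X (suc t) le = *-cancelˡ-≤ (suc t) (begin
    suc t * (L * m′)  ≡⟨ solve 3 (λ t L m → (con 1 :+ t) :* (L :* m) := L :* (con 1 :+ t) :* m) refl t L m′ ⟩
    L * suc t * m′    ≤⟨ *-monoˡ-≤ m′ le ⟩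
    X * m′            ≡⟨ multichoose-absorb-suc X t ⟨
    suc t * multichoose X (suc t) ∎)
  where
  open ≤-Reasoning
  m′ = multichoose′ X (suc t)

ballot-+ : ∀ L X t → L * t ≤ X → ballot L X t + L * multichoose′ X t ≡ multichoose X t
ballot-+ L X t le = m∸n+n≡m (L*multichoose′≤multichoose L X t le)

ballot-vanishes : ∀ L X t → X ≤ L * suc t → ballot L X (suc t) ≡ 0
ballot-vanishes L X t le = m≤n⇒m∸n≡0 (*-cancelˡ-≤ (suc t) (begin
    suc t * multichoose X (suc t) ≡⟨ multichoose-absorb-suc X t ⟩
    X * m′                        ≤⟨ *-monoˡ-≤ m′ le ⟩
    L * suc t * m′                ≡⟨ solve 3 (λ t L m → L :* (con 1 :+ t) :* m := (con 1 :+ t) :* (L :* m)) refl t L m′ ⟩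
    suc t * (L * m′)              ∎))
  where
  open ≤-Reasoning
  m′ = multichoose′ X (suc t)

multichoose′-pascal : ∀ X t → multichoose′ (suc X) (suc t) ≡ multichoose′ (suc X) t + multichoose′ X (suc t)
multichoose′-pascal X zero    = refl
multichoose′-pascal X (suc t) = refl

ballot-pascal : ∀ L X t → L * suc t ≤ X → ballot L (suc X) (suc t) ≡ ballot L (suc X) t + ballot L X (suc t)
ballot-pascal L X t le = +-cancelʳ-≡ (L * multichoose′ (suc X) (suc t)) _ _ (begin
    ballot L (suc X) (suc t) + L * multichoose′ (suc X) (suc t)
  ≡⟨ ballot-+ L (suc X) (suc t) (≤-trans le (n≤1+n X)) ⟩
    multichoose (suc X) t + multichoose X (suc t)
  ≡⟨ cong₂ _+_ (ballot-+ L (suc X) t Lt≤X+1) (ballot-+ L X (suc t) le) ⟨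
    (ballot L (suc X) t + L * multichoose′ (suc X) t) + (ballot L X (suc t) + L * multichoose′ X (suc t))
  ≡⟨ solve 5 (λ p q L u v → (p :+ L :* u) :+ (q :+ L :* v) := p :+ q :+ L :* (u :+ v)) refl
       (ballot L (suc X) t) (ballot L X (suc t)) L (multichoose′ (suc X) t) (multichoose′ X (suc t)) ⟩
    ballot L (suc X) t + ballot L X (suc t) + L * (multichoose′ (suc X) t + multichoose′ X (suc t))
  ≡⟨ cong (λ z → ballot L (suc X) t + ballot L X (suc t) + L * z) (multichoose′-pascal X t) ⟨
    ballot L (suc X) t + ballot L X (suc t) + L * multichoose′ (suc X) (suc t)
  ∎)
  where
  open ≡-Reasoning
  Lt≤X+1 : L * t ≤ suc X
  Lt≤X+1 = ≤-trans (*-monoʳ-≤ L (n≤1+n t)) (≤-trans le (n≤1+n X))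

∑≤-ballot : ∀ L X t → L * t ≤ X → ∑≤ (ballot L X) t ≡ ballot L (suc X) t
∑≤-ballot L X zero    _  = refl
∑≤-ballot L X (suc t) le = begin
    ∑≤ (ballot L X) (suc t)                 ≡⟨ ∑≤-snoc (ballot L X) t ⟩
    ∑≤ (ballot L X) t + ballot L X (suc t)   ≡⟨ cong (_+ ballot L X (suc t)) (∑≤-ballot L X t (≤-trans (*-monoʳ-≤ L (n≤1+n t)) le)) ⟩
    ballot L (suc X) t + ballot L X (suc t)  ≡⟨ ballot-pascal L X t le ⟨
    ballot L (suc X) (suc t)                 ∎
  where open ≡-Reasoning

-- Convolution with ω K is the (K + 1)-fold prefix sum.
ω⋆ballot : ∀ L K X t → L * t ≤ X → (ω K ⋆ ballot L X) t ≡ ballot L (X + suc K) t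
ω⋆ballot L zero    X t le = begin
    (ω 0 ⋆ ballot L X) t  ≡⟨ 1⋆ (ballot L X) t ⟩
    ∑≤ (ballot L X) t     ≡⟨ ∑≤-ballot L X t le ⟩
    ballot L (suc X) t    ≡⟨ cong (λ z → ballot L z t) (+-comm 1 X) ⟩
    ballot L (X + 1) t    ∎
  where open ≡-Reasoning
ω⋆ballot L (suc K) X t le = begin
    (∑≤ (ω K) ⋆ ballot L X) t       ≡⟨ ∑≤-⋆ (ω K) (ballot L X) t ⟩
    (ω K ⋆ ∑≤ (ballot L X)) t       ≡⟨ ⋆-congʳ (ω K) t (λ d d≤t → ∑≤-ballot L X d (≤-trans (*-monoʳ-≤ L d≤t) le)) ⟩
    (ω K ⋆ ballot L (suc X)) t      ≡⟨ ω⋆ballot L K (suc X) t (≤-trans le (n≤1+n X)) ⟩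
    ballot L (suc X + suc K) t      ≡⟨ cong (λ z → ballot L z t) (+-suc X (suc K)) ⟨
    ballot L (X + suc (suc K)) t    ∎
  where open ≡-Reasoning

ballot-! : ∀ L X t → ballot L (suc X) t * t ! * suc X ≡ (suc X ∸ L * t) * rising X t
ballot-! L X t = begin
    (m ∸ L * m′) * t ! * suc X
  ≡⟨ cong (_* suc X) (*-distribʳ-∸ (t !) m (L * m′)) ⟩
    (m * t ! ∸ L * m′ * t !) * suc X
  ≡⟨ *-distribʳ-∸ (suc X) (m * t !) (L * m′ * t !) ⟩
    m * t ! * suc X ∸ L * m′ * t ! * suc X
  ≡⟨ cong₂ _∸_
       (solve 3 (λ m f x → m :* f :* x := x :* (m :* f)) refl m (t !) (suc X))
       (solve 4 (λ L m′ f x → L :* m′ :* f :* x := L :* (x :* m′) :* f) refl L m′ (t !) (suc X)) ⟩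
    suc X * (m * t !) ∸ L * (suc X * m′) * t !
  ≡⟨ cong₂ (λ u v → suc X * u ∸ L * v * t !) (multichoose-! X t) (sym (multichoose-absorb (suc X) t)) ⟩
    suc X * rising X t ∸ L * (t * m) * t !
  ≡⟨ cong (suc X * rising X t ∸_) (trans (solve 4 (λ L t m f → L :* (t :* m) :* f := L :* t :* (m :* f)) refl L t m (t !))
                                          (cong (L * t *_) (multichoose-! X t))) ⟩
    suc X * rising X t ∸ L * t * rising X t
  ≡⟨ *-distribʳ-∸ (rising X t) (suc X) (L * t) ⟨
    (suc X ∸ L * t) * rising X t
  ∎
  where
  open ≡-Reasoning
  m  = multichoose (suc X) t
  m′ = multichoose′ (suc X) t

∑-vecsUpTo-∷ʳ : ∀ n b (F : Vec ℕ (suc n) → ℕ) →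
  ∑ (vecsUpTo (suc n) b) F ≡ ∑[ w ∈ vecsUpTo n b ] ∑[ a ∈ upTo (suc b) ] F (w ∷ʳ a)
∑-vecsUpTo-∷ʳ zero    b F = trans (∑-concatMap (λ a → map (a ∷_) (vecsUpTo zero b)) (upTo (suc b)) F)
  (trans (∑-cong (upTo (suc b)) (λ a → +-identityʳ (F (a ∷ [])))) (sym (+-identityʳ _)))
∑-vecsUpTo-∷ʳ (suc n) b F = begin
    ∑ (vecsUpTo (suc (suc n)) b) F
  ≡⟨ ∑-concatMap (λ c → map (c ∷_) (vecsUpTo (suc n) b)) (upTo (suc b)) F ⟩
    ∑[ c ∈ upTo (suc b) ] ∑ (map (c ∷_) (vecsUpTo (suc n) b)) F
  ≡⟨ ∑-cong (upTo (suc b)) (λ c → trans (∑-map (c ∷_) (vecsUpTo (suc n) b) F) (∑-vecsUpTo-∷ʳ n b (F ∘ (c ∷_)))) ⟩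
    ∑[ c ∈ upTo (suc b) ] ∑[ w ∈ vecsUpTo n b ] ∑[ a ∈ upTo (suc b) ] F (c ∷ (w ∷ʳ a))
  ≡⟨ ∑-cong (upTo (suc b)) (λ c → sym (∑-map (c ∷_) (vecsUpTo n b) _)) ⟩
    ∑[ c ∈ upTo (suc b) ] ∑[ w ∈ map (c ∷_) (vecsUpTo n b) ] ∑[ a ∈ upTo (suc b) ] F (w ∷ʳ a)
  ≡⟨ ∑-concatMap (λ c → map (c ∷_) (vecsUpTo n b)) (upTo (suc b)) _ ⟨
    ∑[ w ∈ vecsUpTo (suc n) b ] ∑[ a ∈ upTo (suc b) ] F (w ∷ʳ a)
  ∎
  where open ≡-Reasoning

vsum-∷ʳ : ∀ {n} (w : Vec ℕ n) a → vsum (w ∷ʳ a) ≡ vsum w + a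
vsum-∷ʳ []      a = +-identityʳ a
vsum-∷ʳ (c ∷ w) a = trans (cong (c +_) (vsum-∷ʳ w a)) (sym (+-assoc c _ a))

Ω-∷ʳ : ∀ {n} K (w : Vec ℕ n) a → Ω K (w ∷ʳ a) ≡ Ω K w * ω K a
Ω-∷ʳ K []      a = trans (*-identityʳ (ω K a)) (sym (*-identityˡ (ω K a)))
Ω-∷ʳ K (c ∷ w) a = trans (cong (ω K c *_) (Ω-∷ʳ K w a)) (sym (*-assoc (ω K c) _ _))

prefixOK-∷ʳ : ∀ {n} m j s (w : Vec ℕ n) a →
  prefixOK m j s (w ∷ʳ a) ≡ (prefixOK m j s w ∧ (m * (s + (vsum w + a)) <ᵇ j + n))
prefixOK-∷ʳ m j s [] a rewrite +-identityʳ j = ∧-identityʳ _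
prefixOK-∷ʳ {suc n} m j s (c ∷ w) a = begin
    here ∧ prefixOK m (suc j) (s + c) (w ∷ʳ a)
  ≡⟨ cong (here ∧_) (prefixOK-∷ʳ m (suc j) (s + c) w a) ⟩
    here ∧ (prefixOK m (suc j) (s + c) w ∧ (m * (s + c + (vsum w + a)) <ᵇ suc j + n))
  ≡⟨ ∧-assoc here _ _ ⟨
    (here ∧ prefixOK m (suc j) (s + c) w) ∧ (m * (s + c + (vsum w + a)) <ᵇ suc j + n)
  ≡⟨ cong ((here ∧ prefixOK m (suc j) (s + c) w) ∧_)
       (cong₂ (λ u v → m * u <ᵇ v) (solve 4 (λ s c v a → s :+ c :+ (v :+ a) := s :+ (c :+ v :+ a)) refl s c (vsum w) a)
                                   (sym (+-suc j n))) ⟩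
    (here ∧ prefixOK m (suc j) (s + c) w) ∧ (m * (s + (c + vsum w + a)) <ᵇ j + suc n)
  ∎
  where
  open ≡-Reasoning
  here = m * (s + c) <ᵇ j

ballotWords : (K m n b t : ℕ) → ℕ
ballotWords K m n b t = ∑[ w ∈ vecsUpTo n b ] (𝟙 (prefixOK m 1 0 w) * 𝟙 (vsum w ≡ᵇ t) * Ω K w)

ballotWords-zero : ∀ K m b t → ballotWords K m 0 b t ≡ 𝟙 (0 ≡ᵇ t)
ballotWords-zero K m b t = trans (+-identityʳ _) (trans (*-identityʳ _) (+-identityʳ _))

ballotWords-suc : ∀ K m n b t → t ≤ b →
  ballotWords K m (suc n) b t ≡ 𝟙 (m * t <ᵇ suc n) * (ω K ⋆ ballotWords K m n b) t
ballotWords-suc K m n b t t≤b = begin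
    ballotWords K m (suc n) b t
  ≡⟨ ∑-vecsUpTo-∷ʳ n b _ ⟩
    ∑[ w ∈ V ] ∑[ a ∈ A ] (𝟙 (prefixOK m 1 0 (w ∷ʳ a)) * 𝟙 (vsum (w ∷ʳ a) ≡ᵇ t) * Ω K (w ∷ʳ a))
  ≡⟨ ∑-cong V (λ w → ∑-cong A (λ a → lastLetter w a)) ⟩
    ∑[ w ∈ V ] ∑[ a ∈ A ] (ok * (𝟙 (a ≤ᵇ t) * (ω K a * word w (t ∸ a))))
  ≡⟨ ∑-comm V A _ ⟩
    ∑[ a ∈ A ] ∑[ w ∈ V ] (ok * (𝟙 (a ≤ᵇ t) * (ω K a * word w (t ∸ a))))
  ≡⟨ ∑-cong A (λ a → trans (∑-*ˡ V ok _) (cong (ok *_) (trans (∑-*ˡ V (𝟙 (a ≤ᵇ t)) _)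
                      (cong (𝟙 (a ≤ᵇ t) *_) (∑-*ˡ V (ω K a) _))))) ⟩
    ∑[ a ∈ A ] (ok * (𝟙 (a ≤ᵇ t) * (ω K a * ballotWords K m n b (t ∸ a))))
  ≡⟨ ∑-*ˡ A ok _ ⟩
    ok * ∑[ a ∈ A ] (𝟙 (a ≤ᵇ t) * (ω K a * ballotWords K m n b (t ∸ a)))
  ≡⟨ cong (ok *_) (trans (∑-upTo b _) (∑≤-restrict (λ a → ω K a * ballotWords K m n b (t ∸ a)) t≤b)) ⟩
    ok * (ω K ⋆ ballotWords K m n b) t
  ∎
  where
  open ≡-Reasoning
  V = vecsUpTo n b
  A = upTo (suc b)
  ok = 𝟙 (m * t <ᵇ suc n)
  word : Vec ℕ n → ℕ → ℕ
  word w u = 𝟙 (prefixOK m 1 0 w) * 𝟙 (vsum w ≡ᵇ u) * Ω K w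
  lastLetter : ∀ w a → 𝟙 (prefixOK m 1 0 (w ∷ʳ a)) * 𝟙 (vsum (w ∷ʳ a) ≡ᵇ t) * Ω K (w ∷ʳ a)
                       ≡ ok * (𝟙 (a ≤ᵇ t) * (ω K a * word w (t ∸ a)))
  lastLetter w a = begin
      𝟙 (prefixOK m 1 0 (w ∷ʳ a)) * 𝟙 (vsum (w ∷ʳ a) ≡ᵇ t) * Ω K (w ∷ʳ a)
    ≡⟨ cong₂ (λ u v → 𝟙 u * 𝟙 (v ≡ᵇ t) * Ω K (w ∷ʳ a)) (prefixOK-∷ʳ m 1 0 w a) (vsum-∷ʳ w a) ⟩
      𝟙 (P ∧ (m * (vsum w + a) <ᵇ suc n)) * 𝟙 (vsum w + a ≡ᵇ t) * Ω K (w ∷ʳ a)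
    ≡⟨ cong₂ _*_ (𝟙-∧-at P (λ v → m * v <ᵇ suc n) (vsum w + a) t) (Ω-∷ʳ K w a) ⟩
      ok * (𝟙 P * 𝟙 (vsum w + a ≡ᵇ t)) * (Ω K w * ω K a)
    ≡⟨ cong (λ z → ok * (𝟙 P * z) * (Ω K w * ω K a)) (𝟙-≡ᵇ-+ (vsum w) a t) ⟩
      ok * (𝟙 P * (𝟙 (a ≤ᵇ t) * 𝟙 (vsum w ≡ᵇ t ∸ a))) * (Ω K w * ω K a)
    ≡⟨ solve 6 (λ c p x y o om → c :* (p :* (x :* y)) :* (o :* om) := c :* (x :* (om :* (p :* y :* o))))
         refl ok (𝟙 P) (𝟙 (a ≤ᵇ t)) (𝟙 (vsum w ≡ᵇ t ∸ a)) (Ω K w) (ω K a) ⟩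
      ok * (𝟙 (a ≤ᵇ t) * (ω K a * word w (t ∸ a)))
    ∎
    where P = prefixOK m 1 0 w

ballotWords≡ballot : ∀ K m n b t → t ≤ b → ballotWords K m n b t ≡ ballot (m * suc K) (n * suc K) t
ballotWords≡ballot K m zero b zero    _ = trans (ballotWords-zero K m b 0) (sym (ballot-zero (m * suc K) 0))
ballotWords≡ballot K m zero b (suc t) _ = trans (ballotWords-zero K m b (suc t)) (sym (ballot-vanishes (m * suc K) 0 t z≤n))
ballotWords≡ballot K m (suc n) b t t≤b = begin
    ballotWords K m (suc n) b t
  ≡⟨ ballotWords-suc K m n b t t≤b ⟩
    𝟙 (m * t <ᵇ suc n) * (ω K ⋆ ballotWords K m n b) t
  ≡⟨ cong (𝟙 (m * t <ᵇ suc n) *_) (⋆-congʳ (ω K) t (λ d d≤t → ballotWords≡ballot K m n b d (≤-trans d≤t t≤b))) ⟩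
    𝟙 (m * t <ᵇ suc n) * (ω K ⋆ ballot L X) t
  ≡⟨ lastStep t (<ᵇ-reflects-< (m * t) (suc n)) ⟩
    ballot L (suc n * suc K) t
  ∎
  where
  open ≡-Reasoning
  L = m * suc K
  X = n * suc K
  lastStep : ∀ t {c} → Reflects (m * t < suc n) c → 𝟙 c * (ω K ⋆ ballot L X) t ≡ ballot L (suc n * suc K) t
  lastStep t (ofʸ mt<n+1) = trans (*-identityˡ _) (trans
    (ω⋆ballot L K X t (subst (_≤ X) (*-comm-middle m t (suc K)) (*-monoˡ-≤ (suc K) (≤-pred mt<n+1))))
    (cong (λ z → ballot L z t) (+-comm X (suc K))))
  lastStep zero     (ofⁿ mt≮n+1) = ⊥-elim (mt≮n+1 (subst (_< suc n) (sym (*-zeroʳ m)) (s≤s z≤n)))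
  lastStep (suc t′) (ofⁿ mt≮n+1) = sym (ballot-vanishes L (suc n * suc K) t′
        (subst (suc n * suc K ≤_) (*-comm-middle m (suc t′) (suc K)) (*-monoˡ-≤ (suc K) (≮⇒≥ mt≮n+1))))

vsum-mono : ∀ {n} (e f : Vec ℕ n) → T (e ≤ʷ f) → vsum e ≤ vsum f
vsum-mono []      []      _   = z≤n
vsum-mono (a ∷ e) (c ∷ f) e≤f with Equivalence.to T-∧ e≤f
... | a≤c , e≤f′ = +-mono-≤ (≤ᵇ⇒≤ a c a≤c) (vsum-mono e f e≤f′)

prefixOK-mono : ∀ {n} m j {s s′} (e f : Vec ℕ n) → s′ ≤ s → T (e ≤ʷ f) → T (prefixOK m j s f) → T (prefixOK m j s′ e)
prefixOK-mono m j []      []      _    _   _  = tt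
prefixOK-mono m j {s} {s′} (a ∷ e) (c ∷ f) s′≤s e≤f ok with Equivalence.to T-∧ e≤f | Equivalence.to T-∧ ok
... | a≤c , e≤f′ | here , rest = Equivalence.from T-∧
  ( <⇒<ᵇ (≤-<-trans (*-monoʳ-≤ m s′+a≤s+c) (<ᵇ⇒< (m * (s + c)) j here))
  , prefixOK-mono m (suc j) e f s′+a≤s+c e≤f′ rest )
  where
  s′+a≤s+c : s′ + a ≤ s + c
  s′+a≤s+c = +-mono-≤ s′≤s (≤ᵇ⇒≤ a c a≤c)

vsum≤⇒All≤ : ∀ {n b} (f : Vec ℕ n) → vsum f ≤ b → All (_≤ b) f
vsum≤⇒All≤ []      _  = []
vsum≤⇒All≤ (a ∷ f) le = ≤-trans (m≤m+n a (vsum f)) le ∷ vsum≤⇒All≤ f (≤-trans (m≤n+m (vsum f) a) le)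

inPF-bounded : ∀ m x y {f : Vec ℕ (x ∸ 1)} → T (inPF m x y f) → All (_≤ y) f
inPF-bounded m x y {f} ok = vsum≤⇒All≤ f (≤ᵇ⇒≤ (vsum f) y (proj₂ (Equivalence.to T-∧ ok)))

inPF-downward : ∀ m x y (e f : Vec ℕ (x ∸ 1)) → T (e ≤ʷ f) → T (inPF m x y f) → T (inPF m x y e)
inPF-downward m x y e f e≤f ok with Equivalence.to T-∧ ok
... | okf , f≤y = Equivalence.from T-∧
  (prefixOK-mono m 1 e f z≤n e≤f okf , ≤⇒≤ᵇ (≤-trans (vsum-mono e f e≤f) (≤ᵇ⇒≤ (vsum f) y f≤y)))

multichainCount≡ballot : ∀ m n y K → m * y ≤ n →
  multichainCount m (suc n) y (suc (suc K)) ≡ ballot (m * suc K) (suc (n * suc K)) y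
multichainCount≡ballot m n y K my≤n = begin
    length (filterᵇ isMultichain (tuples (suc K) (PF m (suc n) y)))
  ≡⟨ length-filterᵇ isMultichain (tuples (suc K) (PF m (suc n) y)) ⟩
    ∑[ es ∈ tuples (suc K) (PF m (suc n) y) ] 𝟙 (isMultichain es)
  ≡⟨ countMultichains K ⟩
    ∑ (PF m (suc n) y) (chainsBelow K)
  ≡⟨ ∑-filterᵇ (inPF m (suc n) y) V (chainsBelow K) ⟩
    ∑[ f ∈ V ] (𝟙 (inPF m (suc n) y f) * chainsBelow K f)
  ≡⟨ ∑-cong V bySum ⟩
    ∑[ f ∈ V ] ∑[ u ≤ y ] (𝟙 (prefixOK m 1 0 f) * 𝟙 (vsum f ≡ᵇ u) * Ω K f)
  ≡⟨ ∑-∑≤ V (λ f u → 𝟙 (prefixOK m 1 0 f) * 𝟙 (vsum f ≡ᵇ u) * Ω K f) y ⟩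
    ∑≤ (ballotWords K m n y) y
  ≡⟨ ∑≤-cong y (λ u u≤y → ballotWords≡ballot K m n y u u≤y) ⟩
    ∑≤ (ballot L X) y
  ≡⟨ ∑≤-ballot L X y (subst (_≤ X) (*-comm-middle m y (suc K)) (*-monoˡ-≤ (suc K) my≤n)) ⟩
    ballot L (suc X) y
  ∎
  where
  open ≡-Reasoning
  open Multichains (PF m (suc n) y)
  open Downset (inPF m (suc n) y) (inPF-bounded m (suc n) y) (λ {e} {f} → inPF-downward m (suc n) y e f)
  V = vecsUpTo n y
  L = m * suc K
  X = n * suc K
  bySum : ∀ f → 𝟙 (inPF m (suc n) y f) * chainsBelow K f
                ≡ ∑[ u ≤ y ] (𝟙 (prefixOK m 1 0 f) * 𝟙 (vsum f ≡ᵇ u) * Ω K f)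
  bySum f = begin
      𝟙 (inPF m (suc n) y f) * chainsBelow K f
    ≡⟨ 𝟙*-cong (inPF m (suc n) y f) (chainsBelow≡Ω K) ⟩
      𝟙 (inPF m (suc n) y f) * Ω K f
    ≡⟨ cong (_* Ω K f) (𝟙-∧ (prefixOK m 1 0 f) (vsum f ≤ᵇ y)) ⟩
      𝟙 (prefixOK m 1 0 f) * 𝟙 (vsum f ≤ᵇ y) * Ω K f
    ≡⟨ cong (λ z → 𝟙 (prefixOK m 1 0 f) * z * Ω K f) (∑≤-𝟙≡ᵇ (vsum f) y) ⟨
      𝟙 (prefixOK m 1 0 f) * ∑[ u ≤ y ] 𝟙 (vsum f ≡ᵇ u) * Ω K f
    ≡⟨ trans (∑≤-*ʳ (Ω K f) _ y) (cong (_* Ω K f) (∑≤-*ˡ (𝟙 (prefixOK m 1 0 f)) _ y)) ⟨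
      ∑[ u ≤ y ] (𝟙 (prefixOK m 1 0 f) * 𝟙 (vsum f ≡ᵇ u) * Ω K f)
    ∎

leadingCoefficient : ∀ m n y k → m * y ≤ n → (suc n ∸ m * y ∸ 1) * k + 1 ≡ suc (n * k) ∸ m * k * y
leadingCoefficient m n y k my≤n = begin
    (suc n ∸ m * y ∸ 1) * k + 1
  ≡⟨ cong (λ z → z * k + 1) (trans (∸-+-assoc (suc n) (m * y) 1) (cong (suc n ∸_) (+-comm (m * y) 1))) ⟩
    (n ∸ m * y) * k + 1
  ≡⟨ cong (_+ 1) (*-distribʳ-∸ k n (m * y)) ⟩
    n * k ∸ m * y * k + 1
  ≡⟨ +-∸-comm 1 (*-monoˡ-≤ k my≤n) ⟨
    n * k + 1 ∸ m * y * k
  ≡⟨ cong₂ _∸_ (+-comm (n * k) 1) (*-comm-middle m y k) ⟩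
    suc (n * k) ∸ m * k * y
  ∎
  where open ≡-Reasoning

theorem6p2 : (m x y : ℕ) → 1 ≤ m → m * y < x → (q : ℕ) → 2 ≤ q →
    multichainCount m x y q * (y !) * ((x ∸ 1) * (q ∸ 1) + 1)
      ≡ ((x ∸ m * y ∸ 1) * (q ∸ 1) + 1) * prodFrom1 x y q
theorem6p2 m (suc n) y _ (s≤s my≤n) (suc (suc K)) (s≤s (s≤s z≤n)) = begin
    multichainCount m (suc n) y (suc (suc K)) * y ! * (X + 1)
  ≡⟨ cong₂ (λ c z → c * y ! * z) (multichainCount≡ballot m n y K my≤n) (+-comm X 1) ⟩
    ballot L (suc X) y * y ! * suc X
  ≡⟨ ballot-! L X y ⟩
    (suc X ∸ L * y) * rising X y
  ≡⟨ cong₂ _*_ (leadingCoefficient m n y (suc K) my≤n)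
               (cong product (map-applyUpTo (λ i → i) (λ i → X + suc i) y)) ⟨
    ((suc n ∸ m * y ∸ 1) * suc K + 1) * prodFrom1 (suc n) y (suc (suc K))
  ∎
  where
  open ≡-Reasoning
  L = m * suc K
  X = n * suc K
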